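{- Let $A=\{a_1,\dots,a_n\}$ be a set of $n$ integers and $k \in \{0,\dots,n-1\}$. Let $S \subseteq k\wedge A$ be the set of integers that have at least two representations as a sum of $k$ distinct elements of $A$ (two representations being different if the underlying $k$-element subsets of $A$ differ). Let $H$ be the bipartite graph with vertex classes $U=\{u_s : s\in k\wedge A\}$ and $V=\{v_t : t \in (k+1)\wedge A\}$, in which $u_s v_t$ is an edge if and only if there exist two distinct $k$-element subsets $\{a'_1,\dots,a'_k\}$ and $\{b_1,\dots,b_k\}$ of $A$ with $s=a'_1+\dots+a'_k=b_1+\dots+b_k$, and an element $a\in A\setminus(\{a'_1,\dots,a'_k\}\cup\{b_1,\dots,b_k\})$ with $t=s+a$. Then $H$ has at least $(n-2k)|S|$ edges.
   Context: For a finite set $A \subseteq \mathbb{Z}$ and integer $j\ge 0$, $j\wedge A$ denotes the set of integers expressible as a sum of $j$ distinct elements of $A$. -}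

module Defs where

open import Data.Nat using (ℕ; zero; suc)
open import Data.Bool using (Bool; true; false; if_then_else_)
open import Data.Integer using (ℤ; _+_; 0ℤ)
import Data.Integer as ℤ
open import Data.Fin using (Fin)
import Data.Fin as Fin
open import Data.Fin.Subset using (Subset; ∣_∣; inside; outside)
open import Data.Vec using (Vec; []; _∷_; lookup)
import Data.Vec.Properties as VecP
import Data.Bool.Properties as BoolP
open import Data.List using (List; []; _∷_; map; concatMap; filter; deduplicate; _++_)
open import Data.Product using (_×_; _,_)
import Data.Product.Properties as ProdP
open import Relation.Nullary using (Dec; yes; no; ¬_)
open import Relation.Nullary.Decidable using (⌊_⌋)
open import Relation.Binary.PropositionalEquality using (_≡_)
import Data.Nat as ℕ

-- Subsets of the index set {0,…,n-1} are characteristic vectors (Data.Fin.Subset).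
-- A finite set A = {a_1,…,a_n} of n integers is given by an injective a : Fin n → ℤ.

subsetSum : ∀ {n} → (Fin n → ℤ) → Subset n → ℤ
subsetSum {zero}  a []             = 0ℤ
subsetSum {suc n} a (true  ∷ p) = a Fin.zero + subsetSum (λ i → a (Fin.suc i)) p
subsetSum {suc n} a (false ∷ p) = subsetSum (λ i → a (Fin.suc i)) p

allSubsets : (n : ℕ) → List (Subset n)
allSubsets zero    = [] ∷ []
allSubsets (suc n) = map (outside ∷_) (allSubsets n) ++ map (inside ∷_) (allSubsets n)

kSubsets : (n k : ℕ) → List (Subset n)
kSubsets n k = filter (λ p → ∣ p ∣ ℕ.≟ k) (allSubsets n)

_≟S_ : ∀ {n} (p q : Subset n) → Dec (p ≡ q)
_≟S_ = VecP.≡-dec BoolP._≟_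

_≟ℤ×ℤ_ : (x y : ℤ × ℤ) → Dec (x ≡ y)
_≟ℤ×ℤ_ = ProdP.≡-dec ℤ._≟_ ℤ._≟_

repSet : ∀ {n} → ℕ → (Fin n → ℤ) → List ℤ
repSet {n} k a = deduplicate ℤ._≟_
  (concatMap (λ P → concatMap (λ Q →
      if ⌊ P ≟S Q ⌋ then []
      else (if ⌊ subsetSum a P ℤ.≟ subsetSum a Q ⌋ then subsetSum a P ∷ [] else []))
    (kSubsets n k)) (kSubsets n k))

-- Edge set of H, identified with the set of pairs (s , t) of integers such that
-- u_s v_t is an edge: there are distinct k-subsets P ≠ Q with
-- s = ΣP = ΣQ, and an index i outside P ∪ Q with t = s + a_i.
-- (Such s automatically lies in k∧A and such t in (k+1)∧A.)
-- Duplicate-free list.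
edgesH : ∀ {n} → ℕ → (Fin n → ℤ) → List (ℤ × ℤ)
edgesH {n} k a = deduplicate _≟ℤ×ℤ_
  (concatMap (λ P → concatMap (λ Q → concatMap (λ i →
      if ⌊ P ≟S Q ⌋ then []
      else (if ⌊ subsetSum a P ℤ.≟ subsetSum a Q ⌋
            then (if lookup P i then []
                  else (if lookup Q i then []
                        else ((subsetSum a P , subsetSum a P + a i) ∷ [])))
            else []))
    (Data.List.allFin n)) (kSubsets n k)) (kSubsets n k))

{-# OPTIONS --safe #-}
module Submission where

-- Each s ∈ S has two representations by distinct k-subsets P ≠ Q of indices. Every index i
-- outside P ∪ Q, of which there are at least n − 2k, yields the edge u_s v_{s+a_i}, and these
-- edges are distinct because a is injective. Edges over different s are different, so double
-- counting the edges by their U-endpoint gives (n − 2k)|S| of them.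

open import Defs
open import Data.Nat using (ℕ; _<_; _≤_; _*_; _∸_)
open import Data.Integer using (ℤ)
open import Data.Fin using (Fin)
open import Data.List using (length)
open import Function.Definitions using (Injective)
open import Relation.Binary.PropositionalEquality using (_≡_)

open import Data.Nat using (suc; _+_; z≤n; s≤s)
import Data.Nat.Properties as ℕ
import Data.Integer as ℤ
import Data.Integer.Properties as ℤ
open import Data.Fin using (zero; suc)
open import Data.Fin.Properties using (suc-injective)
open import Data.Fin.Subset using (Subset; ∣_∣; _∪_; ∁) renaming (_∈_ to _∈ₛ_; _∉_ to _∉ₛ_)
open import Data.Fin.Subset.Properties using (∣∁p∣≡n∸∣p∣; x∈∁p⇒x∉p; x∈p∪q⁺; ∣p∣≤∣x∷p∣)
open import Data.Bool using (true; false; if_then_else_)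
open import Data.Bool.Properties using (¬-not)
open import Data.Vec using ([]; _∷_; lookup; here; there)
open import Data.Vec.Properties using (lookup⇒[]=)
open import Data.List using (List; []; _∷_; _++_; map; concatMap; allFin)
open import Data.List.Properties using (length-++; length-map; length-removeAt′)
open import Data.List.Membership.Propositional using (_∈_; _─_; lose; find)
open import Data.List.Membership.Propositional.Properties
  using (∈-map⁺; ∈-map⁻; ∈-++⁺ˡ; ∈-++⁺ʳ; ∈-++⁻; ∈-concatMap⁺; ∈-concatMap⁻; ∈-filter⁺; ∈-filter⁻;
         ∈-deduplicate⁺; ∈-deduplicate⁻; ∈-allFin)
open import Data.List.Relation.Binary.Subset.Propositional using (_⊆_)
open import Data.List.Relation.Unary.Any using (here; there)
open import Data.List.Relation.Unary.All as All using (All; []; _∷_)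
open import Data.List.Relation.Unary.AllPairs using ([]; _∷_)
open import Data.List.Relation.Unary.Unique.Propositional using (Unique)
import Data.List.Relation.Unary.Unique.Propositional.Properties as Unique
open import Data.List.Relation.Unary.Unique.DecPropositional.Properties using (deduplicate-!)
open import Data.Product using (∃; _×_; _,_; proj₁; proj₂)
open import Data.Sum using (inj₁; inj₂)
open import Data.Empty using (⊥-elim)
open import Function using (_∘_)
open import Relation.Nullary using (yes; no; contraposition)
open import Relation.Nullary.Decidable using (⌊_⌋)
open import Relation.Binary.PropositionalEquality using (_≢_; refl; sym; trans; cong; cong₂; subst)
open import Algebra.Bundles using (AbelianGroup)
import Algebra.Properties.Group as GroupProperties

module _ {A : Set} where

  ∈-─⁺ : ∀ {x y} {ys : List A} (x∈ys : x ∈ ys) → y ∈ ys → y ≢ x → y ∈ ys ─ x∈ys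
  ∈-─⁺ (here refl) (here refl) y≢x = ⊥-elim (y≢x refl)
  ∈-─⁺ (here refl) (there y∈ys) _ = y∈ys
  ∈-─⁺ (there x∈ys) (here refl) _ = here refl
  ∈-─⁺ (there x∈ys) (there y∈ys) y≢x = there (∈-─⁺ x∈ys y∈ys y≢x)

  Unique∧⊆⇒length≤ : ∀ {xs ys : List A} → Unique xs → xs ⊆ ys → length xs ≤ length ys
  Unique∧⊆⇒length≤ {[]} _ _ = z≤n
  Unique∧⊆⇒length≤ {x ∷ xs} {ys} (x∉xs ∷ xs!) xs⊆ys =
    subst (suc (length xs) ≤_) (sym (length-removeAt′ ys _))
      (s≤s (Unique∧⊆⇒length≤ xs! λ y∈xs →
        ∈-─⁺ x∈ys (xs⊆ys (there y∈xs)) (λ y≡x → All.lookup x∉xs y∈xs (sym y≡x))))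
    where x∈ys = xs⊆ys (here refl)

module _ {A B : Set} where

  ∈-concatMap-intro : ∀ (f : A → List B) {x xs y} → x ∈ xs → y ∈ f x → y ∈ concatMap f xs
  ∈-concatMap-intro f x∈xs y∈fx = ∈-concatMap⁺ f (lose x∈xs y∈fx)

  ∈-concatMap-elim : ∀ (f : A → List B) {xs y} → y ∈ concatMap f xs → ∃ λ x → x ∈ xs × y ∈ f x
  ∈-concatMap-elim f = find ∘ ∈-concatMap⁻ f

record Fibre {A B : Set} (f : B → A) (E : List B) (m : ℕ) (x : A) : Set where
  field
    members : List B
    members! : Unique members
    m≤size : m ≤ length members
    members⊆E : members ⊆ E
    lies-over : ∀ {e} → e ∈ members → f e ≡ x

module _ {A B : Set} {f : B → A} {E : List B} {m : ℕ} where
  open Fibre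

  ⋃-fibres : ∀ {xs} → All (Fibre f E m) xs → List B
  ⋃-fibres [] = []
  ⋃-fibres (F ∷ Fs) = members F ++ ⋃-fibres Fs

  ⋃-fibres-lies-over : ∀ {xs} (Fs : All (Fibre f E m) xs) {e} → e ∈ ⋃-fibres Fs → f e ∈ xs
  ⋃-fibres-lies-over (F ∷ Fs) e∈ with ∈-++⁻ (members F) e∈
  ... | inj₁ e∈F = here (lies-over F e∈F)
  ... | inj₂ e∈Fs = there (⋃-fibres-lies-over Fs e∈Fs)

  ⋃-fibres⊆E : ∀ {xs} (Fs : All (Fibre f E m) xs) → ⋃-fibres Fs ⊆ E
  ⋃-fibres⊆E (F ∷ Fs) e∈ with ∈-++⁻ (members F) e∈
  ... | inj₁ e∈F = members⊆E F e∈F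
  ... | inj₂ e∈Fs = ⋃-fibres⊆E Fs e∈Fs

  ⋃-fibres! : ∀ {xs} → Unique xs → (Fs : All (Fibre f E m) xs) → Unique (⋃-fibres Fs)
  ⋃-fibres! [] [] = []
  ⋃-fibres! (x∉xs ∷ xs!) (F ∷ Fs) = Unique.++⁺ (members! F) (⋃-fibres! xs! Fs)
    λ (e∈F , e∈Fs) → All.lookup x∉xs (⋃-fibres-lies-over Fs e∈Fs) (sym (lies-over F e∈F))

  m*length≤length-⋃-fibres : ∀ {xs} (Fs : All (Fibre f E m) xs) → m * length xs ≤ length (⋃-fibres Fs)
  m*length≤length-⋃-fibres [] = ℕ.≤-reflexive (ℕ.*-zeroʳ m)
  m*length≤length-⋃-fibres {x ∷ xs} (F ∷ Fs) = begin
    m * suc (length xs)                        ≡⟨ ℕ.*-suc m (length xs) ⟩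
    m + m * length xs                          ≤⟨ ℕ.+-mono-≤ (m≤size F) (m*length≤length-⋃-fibres Fs) ⟩
    length (members F) + length (⋃-fibres Fs)  ≡⟨ length-++ (members F) ⟨
    length (members F ++ ⋃-fibres Fs)          ∎
    where open ℕ.≤-Reasoning

  double-counting : ∀ {xs} → Unique xs → All (Fibre f E m) xs → m * length xs ≤ length E
  double-counting xs! Fs = ℕ.≤-trans (m*length≤length-⋃-fibres Fs)
    (Unique∧⊆⇒length≤ (⋃-fibres! xs! Fs) (⋃-fibres⊆E Fs))

elements : ∀ {n} → Subset n → List (Fin n)
elements [] = []
elements (true ∷ p) = zero ∷ map suc (elements p)
elements (false ∷ p) = map suc (elements p)

length-elements : ∀ {n} (p : Subset n) → length (elements p) ≡ ∣ p ∣
length-elements [] = refl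
length-elements (true ∷ p) = cong suc (trans (length-map suc (elements p)) (length-elements p))
length-elements (false ∷ p) = trans (length-map suc (elements p)) (length-elements p)

elements! : ∀ {n} (p : Subset n) → Unique (elements p)
elements! [] = []
elements! (true ∷ p) = All.tabulate zero∉ ∷ Unique.map⁺ suc-injective (elements! p)
  where
  zero∉ : ∀ {i} → i ∈ map suc (elements p) → zero ≢ i
  zero∉ i∈ refl with ∈-map⁻ suc i∈
  ... | _ , _ , ()
elements! (false ∷ p) = Unique.map⁺ suc-injective (elements! p)

∈-elements⁻ : ∀ {n} {p : Subset n} {i} → i ∈ elements p → i ∈ₛ p
∈-elements⁻ {p = true ∷ p} (here refl) = here
∈-elements⁻ {p = true ∷ p} (there i∈) with ∈-map⁻ suc i∈
... | j , j∈ , refl = there (∈-elements⁻ j∈)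
∈-elements⁻ {p = false ∷ p} i∈ with ∈-map⁻ suc i∈
... | j , j∈ , refl = there (∈-elements⁻ j∈)

∣p∪q∣≤∣p∣+∣q∣ : ∀ {n} (p q : Subset n) → ∣ p ∪ q ∣ ≤ ∣ p ∣ + ∣ q ∣
∣p∪q∣≤∣p∣+∣q∣ [] [] = z≤n
∣p∪q∣≤∣p∣+∣q∣ (true ∷ p) (x ∷ q) =
  s≤s (ℕ.≤-trans (∣p∪q∣≤∣p∣+∣q∣ p q) (ℕ.+-monoʳ-≤ ∣ p ∣ (∣p∣≤∣x∷p∣ x q)))
∣p∪q∣≤∣p∣+∣q∣ (false ∷ p) (true ∷ q) =
  ℕ.≤-trans (s≤s (∣p∪q∣≤∣p∣+∣q∣ p q)) (ℕ.≤-reflexive (sym (ℕ.+-suc ∣ p ∣ ∣ q ∣)))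
∣p∪q∣≤∣p∣+∣q∣ (false ∷ p) (false ∷ q) = ∣p∪q∣≤∣p∣+∣q∣ p q

∉ₛ⇒lookup≡false : ∀ {n} {p : Subset n} {i} → i ∉ₛ p → lookup p i ≡ false
∉ₛ⇒lookup≡false {p = p} {i} i∉p = ¬-not (contraposition (lookup⇒[]= i p) i∉p)

∈-elements-∁∪⁻ : ∀ {n} (p q : Subset n) {i} → i ∈ elements (∁ (p ∪ q)) →
                 lookup p i ≡ false × lookup q i ≡ false
∈-elements-∁∪⁻ p q i∈ =
  ∉ₛ⇒lookup≡false {p = p} (i∉p∪q ∘ x∈p∪q⁺ {p = p} {q} ∘ inj₁) ,
  ∉ₛ⇒lookup≡false {p = q} (i∉p∪q ∘ x∈p∪q⁺ {p = p} {q} ∘ inj₂)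
  where i∉p∪q = x∈∁p⇒x∉p (∈-elements⁻ i∈)

n∸∣p∣+∣q∣≤length-elements-∁∪ : ∀ {n} (p q : Subset n) →
                                n ∸ (∣ p ∣ + ∣ q ∣) ≤ length (elements (∁ (p ∪ q)))
n∸∣p∣+∣q∣≤length-elements-∁∪ {n} p q = begin
  n ∸ (∣ p ∣ + ∣ q ∣)              ≤⟨ ℕ.∸-monoʳ-≤ n (∣p∪q∣≤∣p∣+∣q∣ p q) ⟩
  n ∸ ∣ p ∪ q ∣                    ≡⟨ ∣∁p∣≡n∸∣p∣ (p ∪ q) ⟨
  ∣ ∁ (p ∪ q) ∣                    ≡⟨ length-elements (∁ (p ∪ q)) ⟨
  length (elements (∁ (p ∪ q)))    ∎
  where open ℕ.≤-Reasoning

∈-allSubsets : ∀ {n} (p : Subset n) → p ∈ allSubsets n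
∈-allSubsets [] = here refl
∈-allSubsets (false ∷ p) = ∈-++⁺ˡ (∈-map⁺ (false ∷_) (∈-allSubsets p))
∈-allSubsets {suc n} (true ∷ p) =
  ∈-++⁺ʳ (map (false ∷_) (allSubsets n)) (∈-map⁺ (true ∷_) (∈-allSubsets p))

∈-kSubsets⁺ : ∀ {n k} (p : Subset n) → ∣ p ∣ ≡ k → p ∈ kSubsets n k
∈-kSubsets⁺ {n} {k} p ∣p∣≡k = ∈-filter⁺ (λ p → ∣ p ∣ ℕ.≟ k) (∈-allSubsets p) ∣p∣≡k

∈-kSubsets⁻ : ∀ {n k} {p : Subset n} → p ∈ kSubsets n k → ∣ p ∣ ≡ k
∈-kSubsets⁻ {n} {k} p∈ = proj₂ (∈-filter⁻ (λ p → ∣ p ∣ ℕ.≟ k) {xs = allSubsets n} p∈)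

record Collision {n} (k : ℕ) (a : Fin n → ℤ) (s : ℤ) : Set where
  field
    P Q : Subset n
    ∣P∣≡k : ∣ P ∣ ≡ k
    ∣Q∣≡k : ∣ Q ∣ ≡ k
    P≢Q : P ≢ Q
    ΣP≡s : subsetSum a P ≡ s
    ΣQ≡s : subsetSum a Q ≡ s

-- The inner bodies of repSet and edgesH, named so that membership in them can be analysed.
commonSum : ∀ {n} → (Fin n → ℤ) → Subset n → Subset n → List ℤ
commonSum a P Q =
  if ⌊ P ≟S Q ⌋ then []
  else (if ⌊ subsetSum a P ℤ.≟ subsetSum a Q ⌋ then subsetSum a P ∷ [] else [])

∈-commonSum⁻ : ∀ {n} (a : Fin n → ℤ) (P Q : Subset n) {s} → s ∈ commonSum a P Q →
               P ≢ Q × subsetSum a P ≡ s × subsetSum a Q ≡ s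
∈-commonSum⁻ a P Q s∈ with P ≟S Q
∈-commonSum⁻ a P Q () | yes _
... | no P≢Q with subsetSum a P ℤ.≟ subsetSum a Q
∈-commonSum⁻ a P Q () | no _ | no _
∈-commonSum⁻ a P Q (here refl) | no P≢Q | yes ΣP≡ΣQ = P≢Q , refl , sym ΣP≡ΣQ

∈-repSet⁻ : ∀ {n k} {a : Fin n → ℤ} {s} → s ∈ repSet k a → Collision k a s
∈-repSet⁻ {n} {k} {a} s∈ =
  let P , P∈ , s∈P = ∈-concatMap-elim (λ P → concatMap (commonSum a P) (kSubsets n k))
                       (∈-deduplicate⁻ ℤ._≟_ _ s∈)
      Q , Q∈ , s∈PQ = ∈-concatMap-elim (commonSum a P) s∈P
      P≢Q , ΣP≡s , ΣQ≡s = ∈-commonSum⁻ a P Q s∈PQ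
  in record { P = P ; Q = Q ; ∣P∣≡k = ∈-kSubsets⁻ P∈ ; ∣Q∣≡k = ∈-kSubsets⁻ Q∈
            ; P≢Q = P≢Q ; ΣP≡s = ΣP≡s ; ΣQ≡s = ΣQ≡s }

edgeVia : ∀ {n} → (Fin n → ℤ) → Subset n → Subset n → Fin n → List (ℤ × ℤ)
edgeVia a P Q i =
  if ⌊ P ≟S Q ⌋ then []
  else (if ⌊ subsetSum a P ℤ.≟ subsetSum a Q ⌋
        then (if lookup P i then []
              else (if lookup Q i then []
                    else ((subsetSum a P , subsetSum a P ℤ.+ a i) ∷ [])))
        else [])

∈-edgeVia⁺ : ∀ {n} (a : Fin n → ℤ) {P Q : Subset n} {i} → P ≢ Q → subsetSum a P ≡ subsetSum a Q →
             lookup P i ≡ false → lookup Q i ≡ false →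
             (subsetSum a P , subsetSum a P ℤ.+ a i) ∈ edgeVia a P Q i
∈-edgeVia⁺ a {P} {Q} P≢Q ΣP≡ΣQ i∉P i∉Q with P ≟S Q
... | yes P≡Q = ⊥-elim (P≢Q P≡Q)
... | no _ with subsetSum a P ℤ.≟ subsetSum a Q
...   | no ΣP≢ΣQ = ⊥-elim (ΣP≢ΣQ ΣP≡ΣQ)
...   | yes _ rewrite i∉P | i∉Q = here refl

∈-edgesH⁺ : ∀ {n k} {a : Fin n → ℤ} {s} (c : Collision k a s) → let open Collision c in
            ∀ {i} → lookup P i ≡ false → lookup Q i ≡ false → (s , s ℤ.+ a i) ∈ edgesH k a
∈-edgesH⁺ {n} {k} {a} c {i} i∉P i∉Q =
  subst (λ s → (s , s ℤ.+ a i) ∈ edgesH k a) ΣP≡s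
    (∈-deduplicate⁺ _≟ℤ×ℤ_
      (∈-concatMap-intro (λ P → concatMap (λ Q → concatMap (edgeVia a P Q) (allFin n)) (kSubsets n k))
        (∈-kSubsets⁺ P ∣P∣≡k)
        (∈-concatMap-intro (λ Q → concatMap (edgeVia a P Q) (allFin n)) (∈-kSubsets⁺ Q ∣Q∣≡k)
          (∈-concatMap-intro (edgeVia a P Q) (∈-allFin i)
            (∈-edgeVia⁺ a P≢Q (trans ΣP≡s (sym ΣQ≡s)) i∉P i∉Q)))))
  where open Collision c

module ℤ+ = GroupProperties (AbelianGroup.group ℤ.+-0-abelianGroup)

collisionFibre : ∀ {n k} {a : Fin n → ℤ} → Injective _≡_ _≡_ a → ∀ {s} →
                 Collision k a s → Fibre proj₁ (edgesH k a) (n ∸ 2 * k) s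
collisionFibre {n} {k} {a} a-injective {s} c = record
  { members = map edgeTo outside
  ; members! = Unique.map⁺ (a-injective ∘ ℤ+.∙-cancelˡ s _ _ ∘ cong proj₂) (elements! (∁ (P ∪ Q)))
  ; m≤size = begin
      n ∸ 2 * k                    ≡⟨ cong (n ∸_) ∣P∣+∣Q∣≡2k ⟨
      n ∸ (∣ P ∣ + ∣ Q ∣)          ≤⟨ n∸∣p∣+∣q∣≤length-elements-∁∪ P Q ⟩
      length outside               ≡⟨ length-map edgeTo outside ⟨
      length (map edgeTo outside)  ∎
  ; members⊆E = λ e∈ → let i , i∈ , e≡ = ∈-map⁻ edgeTo e∈
                           i∉P , i∉Q = ∈-elements-∁∪⁻ P Q i∈
                       in subst (_∈ edgesH k a) (sym e≡) (∈-edgesH⁺ c i∉P i∉Q)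
  ; lies-over = λ e∈ → let _ , _ , e≡ = ∈-map⁻ edgeTo e∈ in cong proj₁ e≡
  }
  where
  open Collision c
  open ℕ.≤-Reasoning
  outside : List (Fin n)
  outside = elements (∁ (P ∪ Q))
  edgeTo : Fin n → ℤ × ℤ
  edgeTo i = s , s ℤ.+ a i
  ∣P∣+∣Q∣≡2k : ∣ P ∣ + ∣ Q ∣ ≡ 2 * k
  ∣P∣+∣Q∣≡2k = cong₂ _+_ ∣P∣≡k (trans ∣Q∣≡k (sym (ℕ.+-identityʳ k)))

lemma2 : (n k : ℕ) (a : Fin n → ℤ) → Injective _≡_ _≡_ a → k < n →
           (n ∸ 2 * k) * length (repSet k a) ≤ length (edgesH k a)
lemma2 n k a a-injective _ =
  double-counting (deduplicate-! ℤ._≟_ _) (All.tabulate (collisionFibre a-injective ∘ ∈-repSet⁻))
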